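{- Let $\mathbb{F}_q$ be a finite field of order $q=p^s$ with $p$ prime. Let $P_1,\dots,P_r \in \mathbb{F}_q[t_1,\dots,t_n]$ be nonzero polynomials, and let $\mathcal{I}\subseteq\{1,\dots,n\}$ be nonempty. Let $f_1,\dots,f_n \in \mathbb{F}_q[t]$ and assume that $f_i(t)=t^{m_i}$ with $m_i$ a positive integer for all $i\in\mathcal{I}$. For $i\in\mathcal{I}$, put $d_i=\gcd(m_i,q-1)$. Suppose that \[ \sum_{j=1}^r \deg_{\mathcal{I}}(P_j) < \sum_{i\in\mathcal{I}} \frac 1{d_i}. \] Then $p$ divides $\# \{ (x_1,\dots,x_n) \in \mathbb{F}_q^n \mid P_j(f_1(x_1),\dots,f_n(x_n)) = 0 \text{ for all } 1 \leq j \leq r\}$.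
   Context: For nonempty $\mathcal{I}\subseteq\{1,\dots,n\}$ and a monomial $a t_1^{m_1}\cdots t_n^{m_n}$ with $a\neq 0$, its $\mathcal{I}$-degree is $\sum_{i\in\mathcal{I}} m_i$; for $P\in\mathbb{F}_q[t_1,\dots,t_n]$, $\deg_{\mathcal{I}}(P)$ is the maximum of the $\mathcal{I}$-degrees of its monomial terms. -}

module Defs where

open import Level using (0ℓ)
open import Data.Bool using (Bool; true; false; if_then_else_; T; _∧_)
open import Data.Nat as ℕ using (ℕ; zero; suc; _∸_; _⊔_)
open import Data.Nat.GCD using (gcd)
open import Data.Fin using (Fin)
open import Data.Fin.Subset using (Subset)
open import Data.List as List using (List; []; _∷_; foldr; map; allFin; filterᵇ; length; concatMap; replicate; _++_)
open import Data.Vec as Vec using (Vec; lookup)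
open import Data.Product using (_×_; _,_; ∃; proj₁; proj₂)
open import Data.List.Relation.Unary.All using (All)
open import Data.List.Relation.Unary.Unique.Propositional using (Unique)
open import Data.Integer using (+_)
open import Data.Rational as ℚ using (ℚ; 0ℚ)
open import Relation.Nullary using (¬_; ⌊_⌋)
open import Relation.Binary.PropositionalEquality using (_≡_)
open import Relation.Binary.Definitions using (DecidableEquality)
open import Algebra.Structures using (IsCommutativeRing)
open import Function.Definitions using (Injective; Surjective)

record FiniteField : Set₁ where
  infixl 7 _*_
  infixl 6 _+_
  field
    Carrier : Set
    _+_ _*_ : Carrier → Carrier → Carrier
    -_      : Carrier → Carrier
    0# 1#   : Carrier
    isCommutativeRing : IsCommutativeRing _≡_ _+_ _*_ -_ 0# 1#
    0≢1     : ¬ (0# ≡ 1#)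
    inverse : ∀ x → ¬ (x ≡ 0#) → ∃ λ y → x * y ≡ 1#
    _≟_     : DecidableEquality Carrier
    order   : ℕ
    enum    : Fin order → Carrier
    enum-injective  : Injective _≡_ _≡_ enum
    enum-surjective : Surjective _≡_ _≡_ enum

module _ (F : FiniteField) where
  open FiniteField F

  pow : Carrier → ℕ → Carrier
  pow x zero    = 1#
  pow x (suc k) = x * pow x k

  -- Univariate polynomials in F[t]: dense coefficient lists
  -- [c₀, c₁, …] represents c₀ + c₁ t + c₂ t² + …

  UPoly : Set
  UPoly = List Carrier

  evalU : UPoly → Carrier → Carrier
  evalU cs x = foldr (λ c acc → c + x * acc) 0# cs

  tPow : ℕ → UPoly
  tPow m = replicate m 0# ++ (1# ∷ [])

  -- Multivariate polynomials in F[t₁,…,tₙ]: lists of monomial terms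
  -- (coefficient , exponent vector).

  Term : ℕ → Set
  Term n = Carrier × Vec ℕ n

  Poly : ℕ → Set
  Poly n = List (Term n)

  IsNormal : {n : ℕ} → Poly n → Set
  IsNormal P = All (λ t → ¬ (proj₁ t ≡ 0#)) P × Unique (map proj₂ P)

  monoEval : {n : ℕ} → Vec Carrier n → Vec ℕ n → Carrier
  monoEval y e = Vec.foldr (λ _ → Carrier) _*_ 1# (Vec.zipWith pow y e)

  eval : {n : ℕ} → Poly n → Vec Carrier n → Carrier
  eval P y = foldr (λ t acc → proj₁ t * monoEval y (proj₂ t) + acc) 0# P

  elems : List Carrier
  elems = map enum (allFin order)

  allVecs : (n : ℕ) → List (Vec Carrier n)
  allVecs zero    = Vec.[] ∷ []
  allVecs (suc n) = concatMap (λ x → map (x Vec.∷_) (allVecs n)) elems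

  zeroCount : (n r : ℕ) → (Fin n → UPoly) → (Fin r → Poly n) → ℕ
  zeroCount n r f P = length (filterᵇ isSol (allVecs n))
    where
    isSol : Vec Carrier n → Bool
    isSol x = foldr (λ b acc → b ∧ acc) true (map (λ j → ⌊ eval (P j) (Vec.tabulate (λ i → evalU (f i) (lookup x i))) ≟ 0# ⌋)
                       (allFin r))

monoDegI : {n : ℕ} → Subset n → Vec ℕ n → ℕ
monoDegI I e = Vec.sum (Vec.zipWith (λ b k → if b then k else 0) I e)

-- deg_𝓘 P = max of 𝓘-degrees of the monomial terms (0 for the empty list)
degI : {n : ℕ} {A : Set} → Subset n → List (A × Vec ℕ n) → ℕ
degI I P = foldr (λ t acc → monoDegI I (proj₂ t) ⊔ acc) 0 P

-- 1/d as a rational (d = 0 never occurs in the statement)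
invℕ : ℕ → ℚ
invℕ zero    = 0ℚ
invℕ (suc k) = (+ 1) ℚ./ suc k

sumOver : {n : ℕ} → Subset n → (Fin n → ℚ) → ℚ
sumOver {n} I g = foldr ℚ._+_ 0ℚ (map (λ i → if lookup I i then g i else 0ℚ) (allFin n))

sumℕ : {r : ℕ} → (Fin r → ℕ) → ℕ
sumℕ {r} a = foldr ℕ._+_ 0 (map a (allFin r))

-- As in Chevalley–Warning, modulo p the number of common zeros is Σ_{x ∈ Fⁿ}
-- Π_j (1 - P_j(f(x))^(q-1)), since a^(q-1) is 1 on units and 0 at 0.  Expand the product
-- into monomials t^k; each has I-degree at most (q-1) Σ_j deg_I P_j.  Summing t^k at f(x) over Fⁿ
-- factors as Π_i Σ_{z ∈ F} f_i(z)^(k_i), and for i ∈ I the factor is the power sum Σ_z z^(m_i k_i),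
-- which vanishes unless q-1 divides m_i k_i > 0, i.e. unless k_i ≥ (q-1)/d_i.  If this held for all
-- i ∈ I, the I-degree of t^k would be at least (q-1) Σ_{i ∈ I} 1/d_i, exceeding the bound.  So every
-- monomial sums to 0 in F, and as F has characteristic p, p divides the count.

module Submission where

open import Defs

open import Level using (0ℓ)
open import Algebra.Bundles using (CommutativeMonoid; CommutativeRing; CancellativeCommutativeSemiring)
open import Algebra.Core using (Op₂)
open import Algebra.Definitions using (AlmostLeftCancellative)
open import Algebra.Structures using (IsCommutativeMonoid)
open import Data.Bool using (Bool; true; false; _∧_; if_then_else_)
open import Data.Empty using (⊥-elim)
open import Data.Fin using (Fin; zero; suc)
open import Data.Fin.Permutation using (permutation)
open import Data.Fin.Subset using (Subset; Nonempty; _∈_)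
open import Data.Fin.Subset.Properties using (_∈?_)
open import Data.List as List using (List; []; _∷_; foldr; length; filterᵇ; map; allFin; tabulate; _++_; concatMap)
open import Data.List.Properties using (map-tabulate; length-map; length-tabulate; length-replicate)
open import Data.List.Membership.Propositional using () renaming (_∈_ to _∈ₗ_; _∉_ to _∉ₗ_)
open import Data.List.Membership.Propositional.Properties using (∈-map⁺; ∈-allFin)
open import Data.List.Relation.Unary.All as All using (All; []; _∷_)
import Data.List.Relation.Unary.All.Properties as Allₚ
open import Data.List.Relation.Unary.AllPairs using (_∷_)
open import Data.List.Relation.Unary.Any as Any using ()
open import Data.List.Relation.Unary.Unique.Propositional using (Unique)
import Data.List.Relation.Unary.Unique.Propositional.Properties as Unique
open import Data.Maybe using (nothing)
open import Data.Nat as ℕ using (ℕ; zero; suc; _∸_)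
import Data.Nat.Properties as ℕₚ
open import Data.Nat.Coprimality as Coprimality using (Coprime; coprime-Bézout; 1-coprimeTo)
open import Data.Nat.DivMod using (_%_; _/_; m≡m%n+[m/n]*n; m%n<n)
open import Data.Nat.Divisibility using (_∣_; _∣?_; m%n≡0⇒n∣m; ∣⇒≤; n∣m*n)
open import Data.Nat.GCD using (module Bézout; gcd; gcd-greatest; gcd[m,n]≢0; c*gcd[m,n]≡gcd[cm,cn])
open import Data.Nat.Primality using (Prime; prime⇒irreducible)
open import Data.Product using (_×_; _,_; proj₁; proj₂; map₁; uncurry)
open import Data.Rational as ℚ using (ℚ; mkℚ; 0ℚ; 1ℚ)
import Data.Rational.Properties as ℚₚ
open import Data.Sum as Sum using (_⊎_; inj₁; inj₂)
open import Data.Vec as Vec using (Vec; []; _∷_; here; there)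
open import Function using (_∘_; id)
open import Function.Definitions using (Injective; Surjective)
open import Relation.Nullary using (¬_; yes; no; ⌊_⌋)
open import Relation.Binary.PropositionalEquality
open import Tactic.RingSolver using (solve-∀)
open import Tactic.RingSolver.Core.AlmostCommutativeRing using (AlmostCommutativeRing; fromCommutativeRing)

-- Folds in a commutative monoid

module ListFold {A : Set} {_∙_ : Op₂ A} {ε : A} (isCM : IsCommutativeMonoid _≡_ _∙_ ε) where
  private
    M : CommutativeMonoid 0ℓ 0ℓ
    M = record { isCommutativeMonoid = isCM }
  open CommutativeMonoid M using (identityˡ; assoc; commutativeSemigroup)
  open import Algebra.Properties.CommutativeMonoid.Sum M using (sum; sum-cong-≗; sum-permute)
  open import Algebra.Properties.CommutativeSemigroup commutativeSemigroup using (interchange)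

  fold : {X : Set} → List X → (X → A) → A
  fold L g = foldr (λ x acc → g x ∙ acc) ε L

  fold-cong : {X : Set} (L : List X) {g h : X → A} → (∀ x → g x ≡ h x) → fold L g ≡ fold L h
  fold-cong []      g≗h = refl
  fold-cong (x ∷ L) g≗h = cong₂ _∙_ (g≗h x) (fold-cong L g≗h)

  fold-ε : {X : Set} (L : List X) → fold L (λ _ → ε) ≡ ε
  fold-ε []      = refl
  fold-ε (x ∷ L) = trans (identityˡ _) (fold-ε L)

  fold-∙ : {X : Set} (L : List X) (g h : X → A) → fold L (λ x → g x ∙ h x) ≡ fold L g ∙ fold L h
  fold-∙ []      g h = sym (identityˡ ε)
  fold-∙ (x ∷ L) g h = trans (cong ((g x ∙ h x) ∙_) (fold-∙ L g h)) (interchange _ _ _ _)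

  fold-++ : {X : Set} (L L′ : List X) (g : X → A) → fold (L ++ L′) g ≡ fold L g ∙ fold L′ g
  fold-++ []      L′ g = sym (identityˡ _)
  fold-++ (x ∷ L) L′ g = trans (cong (g x ∙_) (fold-++ L L′ g)) (sym (assoc _ _ _))

  fold-concatMap : {X Y : Set} (L : List X) (k : X → List Y) (g : Y → A) →
                   fold (concatMap k L) g ≡ fold L (λ x → fold (k x) g)
  fold-concatMap []      k g = refl
  fold-concatMap (x ∷ L) k g = trans (fold-++ (k x) (concatMap k L) g) (cong (_ ∙_) (fold-concatMap L k g))

  fold-map : {X Y : Set} (L : List X) (k : X → Y) (g : Y → A) → fold (map k L) g ≡ fold L (g ∘ k)
  fold-map []      k g = refl
  fold-map (x ∷ L) k g = cong (g (k x) ∙_) (fold-map L k g)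

  fold-tabulate : ∀ {n} {X : Set} (h : Fin n → X) (g : X → A) → fold (tabulate h) g ≡ sum (g ∘ h)
  fold-tabulate {zero}  h g = refl
  fold-tabulate {suc n} h g = cong (g (h zero) ∙_) (fold-tabulate (h ∘ suc) g)

  fold-allFin-suc : ∀ {n} (g : Fin (suc n) → A) → fold (allFin (suc n)) g ≡ g zero ∙ fold (allFin n) (g ∘ suc)
  fold-allFin-suc {n} g = cong (g zero ∙_) (trans (fold-tabulate suc g) (sym (fold-tabulate id (g ∘ suc))))

  fold-enum-bijection : ∀ {n} {X : Set} (enum : Fin n → X) → Injective _≡_ _≡_ enum → Surjective _≡_ _≡_ enum →
    (φ ψ : X → X) → (∀ x → φ (ψ x) ≡ x) → (∀ x → ψ (φ x) ≡ x) →
    (g : X → A) → fold (map enum (allFin n)) (g ∘ φ) ≡ fold (map enum (allFin n)) g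
  fold-enum-bijection {n} {X} enum inj surj φ ψ φψ ψφ g = begin
    fold (map enum (allFin n)) (g ∘ φ) ≡⟨ fold-map (allFin n) enum (g ∘ φ) ⟩
    fold (allFin n) (g ∘ φ ∘ enum)     ≡⟨ fold-tabulate id (g ∘ φ ∘ enum) ⟩
    sum (g ∘ φ ∘ enum)                 ≡⟨ sum-cong-≗ {n} (λ i → cong g (sym (enum-unenum (φ (enum i))))) ⟩
    sum (g ∘ enum ∘ φ′)                ≡⟨ sym (sum-permute (g ∘ enum) (permutation φ′ ψ′ φ′ψ′ ψ′φ′)) ⟩
    sum (g ∘ enum)                     ≡⟨ sym (fold-tabulate id (g ∘ enum)) ⟩
    fold (allFin n) (g ∘ enum)         ≡⟨ sym (fold-map (allFin n) enum g) ⟩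
    fold (map enum (allFin n)) g       ∎
    where
    open ≡-Reasoning
    unenum : X → Fin n
    unenum x = proj₁ (surj x)
    enum-unenum : ∀ x → enum (unenum x) ≡ x
    enum-unenum x = proj₂ (surj x) refl
    φ′ ψ′ : Fin n → Fin n
    φ′ = unenum ∘ φ ∘ enum
    ψ′ = unenum ∘ ψ ∘ enum
    φ′ψ′ : ∀ i → φ′ (ψ′ i) ≡ i
    φ′ψ′ i = inj (trans (enum-unenum _) (trans (cong φ (enum-unenum _)) (φψ (enum i))))
    ψ′φ′ : ∀ i → ψ′ (φ′ i) ≡ i
    ψ′φ′ i = inj (trans (enum-unenum _) (trans (cong ψ (enum-unenum _)) (ψφ (enum i))))

monoDegI-replicate-0 : ∀ {n} (I : Subset n) → monoDegI I (Vec.replicate n 0) ≡ 0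
monoDegI-replicate-0 []          = refl
monoDegI-replicate-0 (true ∷ I)  = monoDegI-replicate-0 I
monoDegI-replicate-0 (false ∷ I) = monoDegI-replicate-0 I

monoDegI-+ : ∀ {n} (I : Subset n) e e′ → monoDegI I (Vec.zipWith ℕ._+_ e e′) ≡ monoDegI I e ℕ.+ monoDegI I e′
monoDegI-+ []          []      []       = refl
monoDegI-+ (true ∷ I)  (a ∷ e) (b ∷ e′) = trans (cong (a ℕ.+ b ℕ.+_) (monoDegI-+ I e e′)) (+-interchange a b _ _)
  where open import Algebra.Properties.CommutativeSemigroup ℕₚ.+-commutativeSemigroup using () renaming (interchange to +-interchange)
monoDegI-+ (false ∷ I) (a ∷ e) (b ∷ e′) = monoDegI-+ I e e′

foldr-+-map-*ˡ : {X : Set} (c : ℕ) (g : X → ℕ) (L : List X) →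
                 foldr ℕ._+_ 0 (map (λ x → c ℕ.* g x) L) ≡ c ℕ.* foldr ℕ._+_ 0 (map g L)
foldr-+-map-*ˡ c g []      = sym (ℕₚ.*-zeroʳ c)
foldr-+-map-*ˡ c g (x ∷ L) = trans (cong (c ℕ.* g x ℕ.+_) (foldr-+-map-*ˡ c g L)) (sym (ℕₚ.*-distribˡ-+ c (g x) _))

DegreeI≤ : ∀ {n} {A : Set} → Subset n → ℕ → List (A × Vec ℕ n) → Set
DegreeI≤ I D P = All (λ t → monoDegI I (proj₂ t) ℕ.≤ D) P

degI-DegreeI≤ : ∀ {n} {A : Set} (I : Subset n) (P : List (A × Vec ℕ n)) → DegreeI≤ I (degI I P) P
degI-DegreeI≤ I []      = []
degI-DegreeI≤ I (t ∷ P) =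
  ℕₚ.m≤m⊔n _ _ ∷ All.map (λ d≤ → ℕₚ.≤-trans d≤ (ℕₚ.m≤n⊔m (monoDegI I (proj₂ t)) _)) (degI-DegreeI≤ I P)

DegreeI≤-weaken : ∀ {n} {A : Set} {I : Subset n} {D D′} {P : List (A × Vec ℕ n)} →
                  D ℕ.≤ D′ → DegreeI≤ I D P → DegreeI≤ I D′ P
DegreeI≤-weaken D≤D′ = All.map (λ d≤D → ℕₚ.≤-trans d≤D D≤D′)

-- Arithmetic in a finite field

module _ (F : FiniteField) where
  open FiniteField F using (Carrier; isCommutativeRing; 0≢1; inverse; _≟_; order; enum; enum-injective; enum-surjective)

  commutativeRing : CommutativeRing 0ℓ 0ℓ
  commutativeRing = record { isCommutativeRing = isCommutativeRing }

  open CommutativeRing commutativeRing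
    using (_+_; _*_; -_; 0#; 1#; +-identityˡ; +-identityʳ; +-assoc; -‿inverseˡ; -‿inverseʳ;
           *-identityˡ; *-identityʳ; *-assoc; *-comm; zeroˡ; zeroʳ; distribˡ; distribʳ;
           ring; semiring; commutativeSemiring; isCommutativeSemiring;
           +-isCommutativeMonoid; *-isCommutativeMonoid; *-commutativeSemigroup)
  open import Algebra.Properties.Ring ring using (-0#≈0#; +-cancelˡ; -‿distribˡ-*; -‿distribʳ-*; -‿+-comm)
  open import Algebra.Properties.Semiring.Mult semiring using (×1-homo-*) renaming (_×_ to _·_)
  open import Algebra.Properties.CommutativeSemiring.Exp commutativeSemiring using (_^_; ^-homo-*; ^-assocʳ; ^-distrib-*)
  open import Algebra.Properties.CommutativeSemigroup *-commutativeSemigroup using () renaming (interchange to *-interchange)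
  open ≡-Reasoning

  *-cancelˡ-nonZero : AlmostLeftCancellative _≡_ 0# _*_
  *-cancelˡ-nonZero x y z x≢0 xy≡xz with inverse x x≢0
  ... | x⁻¹ , xx⁻¹≡1 = begin
    y              ≡⟨ sym (*-identityˡ y) ⟩
    1# * y         ≡⟨ cong (_* y) (trans (sym xx⁻¹≡1) (*-comm x x⁻¹)) ⟩
    x⁻¹ * x * y    ≡⟨ *-assoc x⁻¹ x y ⟩
    x⁻¹ * (x * y)  ≡⟨ cong (x⁻¹ *_) xy≡xz ⟩
    x⁻¹ * (x * z)  ≡⟨ sym (*-assoc x⁻¹ x z) ⟩
    x⁻¹ * x * z    ≡⟨ cong (_* z) (trans (*-comm x⁻¹ x) xx⁻¹≡1) ⟩
    1# * z         ≡⟨ *-identityˡ z ⟩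
    z              ∎

  cancellativeCommutativeSemiring : CancellativeCommutativeSemiring 0ℓ 0ℓ
  cancellativeCommutativeSemiring = record
    { isCancellativeCommutativeSemiring = record
      { isCommutativeSemiring = isCommutativeSemiring ; *-cancelˡ-nonZero = *-cancelˡ-nonZero } }

  open import Algebra.Properties.CancellativeCommutativeSemiring cancellativeCommutativeSemiring
    using (*-almostCancelʳ; xy≈0⇒x≈0∨y≈0; x≉0∧y≉0⇒xy≉0)

  pow≗^ : ∀ x k → pow F x k ≡ x ^ k
  pow≗^ x zero    = refl
  pow≗^ x (suc k) = cong (x *_) (pow≗^ x k)

  ^-nonZero : ∀ {x} k → x ≢ 0# → x ^ k ≢ 0#
  ^-nonZero zero    x≢0 1≡0 = 0≢1 (sym 1≡0)
  ^-nonZero (suc k) x≢0     = x≉0∧y≉0⇒xy≉0 _≟_ x≢0 (^-nonZero k x≢0)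

  module ∑M = ListFold +-isCommutativeMonoid
  module ∏M = ListFold *-isCommutativeMonoid
  open ∑M public using () renaming (fold to ∑)
  open ∏M public using () renaming (fold to ∏)

  ∑-*ˡ : {X : Set} (L : List X) (a : Carrier) (g : X → Carrier) → ∑ L (λ x → a * g x) ≡ a * ∑ L g
  ∑-*ˡ []      a g = sym (zeroʳ a)
  ∑-*ˡ (x ∷ L) a g = trans (cong (a * g x +_) (∑-*ˡ L a g)) (sym (distribˡ a (g x) _))

  ∑-*ʳ : {X : Set} (L : List X) (a : Carrier) (g : X → Carrier) → ∑ L (λ x → g x * a) ≡ ∑ L g * a
  ∑-*ʳ L a g = trans (∑M.fold-cong L (λ x → *-comm (g x) a)) (trans (∑-*ˡ L a g) (*-comm a _))

  ∑-1# : {X : Set} (L : List X) → ∑ L (λ _ → 1#) ≡ length L · 1#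
  ∑-1# []      = refl
  ∑-1# (x ∷ L) = cong (1# +_) (∑-1# L)

  length-elems : length (elems F) ≡ order
  length-elems = trans (length-map enum (allFin order)) (length-tabulate id)

  ∈-elems : ∀ x → x ∈ₗ elems F
  ∈-elems x = subst (_∈ₗ elems F) (proj₂ (enum-surjective x) refl) (∈-map⁺ enum (∈-allFin _))

  elems-unique : Unique (elems F)
  elems-unique = Unique.map⁺ enum-injective (Unique.allFin⁺ order)

  module _ (φ ψ : Carrier → Carrier) (φψ : ∀ x → φ (ψ x) ≡ x) (ψφ : ∀ x → ψ (φ x) ≡ x) where
    ∑-bijection : (g : Carrier → Carrier) → ∑ (elems F) (g ∘ φ) ≡ ∑ (elems F) g
    ∑-bijection = ∑M.fold-enum-bijection enum enum-injective enum-surjective φ ψ φψ ψφ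

    ∏-bijection : (g : Carrier → Carrier) → ∏ (elems F) (g ∘ φ) ≡ ∏ (elems F) g
    ∏-bijection = ∏M.fold-enum-bijection enum enum-injective enum-surjective φ ψ φψ ψφ

  order·1≡0 : order · 1# ≡ 0#
  order·1≡0 = +-cancelˡ (∑ (elems F) id) _ _ (begin
    ∑ (elems F) id + order · 1#
      ≡⟨ cong (∑ (elems F) id +_) (sym (trans (∑-1# (elems F)) (cong (_· 1#) length-elems))) ⟩
    ∑ (elems F) id + ∑ (elems F) (λ _ → 1#)
      ≡⟨ sym (∑M.fold-∙ (elems F) id (λ _ → 1#)) ⟩
    ∑ (elems F) (_+ 1#)
      ≡⟨ ∑-bijection (_+ 1#) (_+ - 1#) (cancel (- 1#) 1# (-‿inverseˡ 1#)) (cancel 1# (- 1#) (-‿inverseʳ 1#)) id ⟩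
    ∑ (elems F) id
      ≡⟨ sym (+-identityʳ _) ⟩
    ∑ (elems F) id + 0#
      ∎)
    where
    cancel : ∀ a b → a + b ≡ 0# → ∀ x → x + a + b ≡ x
    cancel a b a+b≡0 x = trans (+-assoc x a b) (trans (cong (x +_) a+b≡0) (+-identityʳ x))

  ·1-homo-^ : ∀ a s → (a ℕ.^ s) · 1# ≡ (a · 1#) ^ s
  ·1-homo-^ a zero    = +-identityʳ 1#
  ·1-homo-^ a (suc s) = trans (×1-homo-* a (a ℕ.^ s)) (cong ((a · 1#) *_) (·1-homo-^ a s))

  p·1≡0 : ∀ {p s} → order ≡ p ℕ.^ s → p · 1# ≡ 0#
  p·1≡0 {p} {s} order≡p^s with (p · 1#) ≟ 0#
  ... | yes p·1≡0 = p·1≡0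
  ... | no  p·1≢0 = ⊥-elim (^-nonZero s p·1≢0 (begin
    (p · 1#) ^ s    ≡⟨ sym (·1-homo-^ p s) ⟩
    (p ℕ.^ s) · 1#  ≡⟨ cong (_· 1#) (sym order≡p^s) ⟩
    order · 1#      ≡⟨ order·1≡0 ⟩
    0#              ∎))

  ·1-zeroʳ : ∀ x {m} → m · 1# ≡ 0# → (x ℕ.* m) · 1# ≡ 0#
  ·1-zeroʳ x {m} m·1≡0 = trans (×1-homo-* x m) (trans (cong ((x · 1#) *_) m·1≡0) (zeroʳ _))

  suc·1≢0 : ∀ {a} → a · 1# ≡ 0# → suc a · 1# ≢ 0#
  suc·1≢0 {a} a·1≡0 1+a·1≡0 = 0≢1 (sym (begin
    1#             ≡⟨ sym (+-identityʳ 1#) ⟩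
    1# + 0#        ≡⟨ cong (1# +_) (sym a·1≡0) ⟩
    1# + a · 1#    ≡⟨ 1+a·1≡0 ⟩
    0#             ∎))

  prime-∣-char : ∀ {p N} → Prime p → p · 1# ≡ 0# → N · 1# ≡ 0# → p ∣ N
  prime-∣-char {p} {N} p-prime p·1≡0 N·1≡0 with p ∣? N
  ... | yes p∣N = p∣N
  ... | no  p∤N with coprime-Bézout coprime
    where
    coprime : Coprime p N
    coprime (d∣p , d∣N) with prime⇒irreducible p-prime d∣p
    ... | inj₁ d≡1 = d≡1
    ... | inj₂ d≡p = ⊥-elim (p∤N (subst (_∣ N) d≡p d∣N))
  ... | Bézout.+- x y 1+yN≡xp =
    ⊥-elim (suc·1≢0 {y ℕ.* N} (·1-zeroʳ y {N} N·1≡0) (trans (cong (_· 1#) 1+yN≡xp) (·1-zeroʳ x {p} p·1≡0)))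
  ... | Bézout.-+ x y 1+xp≡yN =
    ⊥-elim (suc·1≢0 {x ℕ.* p} (·1-zeroʳ x {p} p·1≡0) (trans (cong (_· 1#) 1+xp≡yN) (·1-zeroʳ y {N} N·1≡0)))

  1<order : 1 ℕ.< order
  1<order = distinct⇒1< (unenum 0#) (unenum 1#) (λ eq → 0≢1 (trans (sym (enum-unenum 0#)) (trans (cong enum eq) (enum-unenum 1#))))
    where
    unenum : Carrier → Fin order
    unenum x = proj₁ (enum-surjective x)
    enum-unenum : ∀ x → enum (unenum x) ≡ x
    enum-unenum x = proj₂ (enum-surjective x) refl
    distinct⇒1< : ∀ {n} (i j : Fin n) → i ≢ j → 1 ℕ.< n
    distinct⇒1< {suc zero}    zero zero i≢j = ⊥-elim (i≢j refl)
    distinct⇒1< {suc (suc n)} _    _    _   = ℕ.s≤s (ℕ.s≤s ℕ.z≤n)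

  instance
    order∸1-nonZero : ℕ.NonZero (order ∸ 1)
    order∸1-nonZero = ℕ.>-nonZero (ℕₚ.m<n⇒0<n∸m 1<order)

  order≡suc[order∸1] : order ≡ suc (order ∸ 1)
  order≡suc[order∸1] = sym (trans (ℕₚ.+-comm 1 (order ∸ 1)) (ℕₚ.m∸n+n≡m (ℕₚ.<⇒≤ 1<order)))

  unitPart : Carrier → Carrier
  unitPart x with x ≟ 0#
  ... | yes _ = 1#
  ... | no  _ = x

  unitScale : Carrier → Carrier → Carrier
  unitScale y x with x ≟ 0#
  ... | yes _ = 1#
  ... | no  _ = y

  unitPart-nonZero : ∀ x → unitPart x ≢ 0#
  unitPart-nonZero x with x ≟ 0#
  ... | yes _   = λ 1≡0 → 0≢1 (sym 1≡0)
  ... | no  x≢0 = x≢0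

  unitPart-* : ∀ {y} → y ≢ 0# → ∀ x → unitPart (y * x) ≡ unitScale y x * unitPart x
  unitPart-* {y} y≢0 x with x ≟ 0# | (y * x) ≟ 0#
  ... | yes _   | yes _    = sym (*-identityˡ 1#)
  ... | yes x≡0 | no  yx≢0 = ⊥-elim (yx≢0 (trans (cong (y *_) x≡0) (zeroʳ y)))
  ... | no  x≢0 | yes yx≡0 = ⊥-elim (x≉0∧y≉0⇒xy≉0 _≟_ y≢0 x≢0 yx≡0)
  ... | no  _   | no  _    = refl

  ∏-unitScale-units : ∀ y L → 0# ∉ₗ L → ∏ L (unitScale y) ≡ y ^ length L
  ∏-unitScale-units y []      _   = refl
  ∏-unitScale-units y (x ∷ L) 0∉ with x ≟ 0#
  ... | yes x≡0 = ⊥-elim (0∉ (Any.here (sym x≡0)))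
  ... | no  _   = cong (y *_) (∏-unitScale-units y L (0∉ ∘ Any.there))

  ∏-unitScale : ∀ y L → Unique L → 0# ∈ₗ L → y * ∏ L (unitScale y) ≡ y ^ length L
  ∏-unitScale y (x ∷ L) (x∉L ∷ L-unique) 0∈ with x ≟ 0#
  ... | yes x≡0 = cong (y *_) (trans (*-identityˡ _) (∏-unitScale-units y L (λ 0∈L → All.lookup x∉L 0∈L x≡0)))
  ∏-unitScale y (x ∷ L) (_ ∷ L-unique) (Any.here 0≡x)  | no x≢0 = ⊥-elim (x≢0 (sym 0≡x))
  ∏-unitScale y (x ∷ L) (_ ∷ L-unique) (Any.there 0∈L) | no _   = cong (y *_) (∏-unitScale y L L-unique 0∈L)

  ∏-nonZero : {X : Set} (L : List X) {g : X → Carrier} → (∀ x → g x ≢ 0#) → ∏ L g ≢ 0#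
  ∏-nonZero []      g≢0 1≡0 = 0≢1 (sym 1≡0)
  ∏-nonZero (x ∷ L) g≢0     = x≉0∧y≉0⇒xy≉0 _≟_ (g≢0 x) (∏-nonZero L g≢0)

  module _ {y} (y≢0 : y ≢ 0#) where
    private
      y⁻¹ : Carrier
      y⁻¹ = proj₁ (inverse y y≢0)
      yy⁻¹≡1 : y * y⁻¹ ≡ 1#
      yy⁻¹≡1 = proj₂ (inverse y y≢0)
      cancel : ∀ {a b} → a * b ≡ 1# → ∀ x → a * (b * x) ≡ x
      cancel {a} {b} ab≡1 x = trans (sym (*-assoc a b x)) (trans (cong (_* x) ab≡1) (*-identityˡ x))

    ∑-*-invariant : (g : Carrier → Carrier) → ∑ (elems F) (g ∘ (y *_)) ≡ ∑ (elems F) g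
    ∑-*-invariant = ∑-bijection (y *_) (y⁻¹ *_) (cancel yy⁻¹≡1) (cancel (trans (*-comm y⁻¹ y) yy⁻¹≡1))

    ∏-*-invariant : (g : Carrier → Carrier) → ∏ (elems F) (g ∘ (y *_)) ≡ ∏ (elems F) g
    ∏-*-invariant = ∏-bijection (y *_) (y⁻¹ *_) (cancel yy⁻¹≡1) (cancel (trans (*-comm y⁻¹ y) yy⁻¹≡1))

  ∏-unitScale≡1 : ∀ {y} → y ≢ 0# → ∏ (elems F) (unitScale y) ≡ 1#
  ∏-unitScale≡1 {y} y≢0 = *-almostCancelʳ _ _ _ (∏-nonZero (elems F) unitPart-nonZero) (begin
    ∏ (elems F) (unitScale y) * ∏ (elems F) unitPart   ≡⟨ sym (∏M.fold-∙ (elems F) (unitScale y) unitPart) ⟩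
    ∏ (elems F) (λ x → unitScale y x * unitPart x)     ≡⟨ ∏M.fold-cong (elems F) (λ x → sym (unitPart-* y≢0 x)) ⟩
    ∏ (elems F) (unitPart ∘ (y *_))                    ≡⟨ ∏-*-invariant y≢0 unitPart ⟩
    ∏ (elems F) unitPart                               ≡⟨ sym (*-identityˡ _) ⟩
    1# * ∏ (elems F) unitPart                          ∎)

  -- Multiplication by y ≠ 0 permutes F, and unitPart (y * x) ≡ unitScale y x * unitPart x, where
  -- unitScale y is y on the q - 1 units and 1 at 0; so ∏ (unitScale y) = y ^ (q - 1) must be 1.
  fermat : ∀ {y} → y ≢ 0# → y ^ (order ∸ 1) ≡ 1#
  fermat {y} y≢0 = *-cancelˡ-nonZero y _ _ y≢0 (begin
    y ^ suc (order ∸ 1)                   ≡⟨ cong (y ^_) (sym order≡suc[order∸1]) ⟩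
    y ^ order                             ≡⟨ cong (y ^_) (sym length-elems) ⟩
    y ^ length (elems F)                  ≡⟨ sym (∏-unitScale y (elems F) elems-unique (∈-elems 0#)) ⟩
    y * ∏ (elems F) (unitScale y)         ≡⟨ cong (y *_) (∏-unitScale≡1 y≢0) ⟩
    y * 1#                                ∎)

  1#^≡1# : ∀ k → 1# ^ k ≡ 1#
  1#^≡1# zero    = refl
  1#^≡1# (suc k) = trans (*-identityˡ _) (1#^≡1# k)

  infixl 6 _-_
  _-_ : Carrier → Carrier → Carrier
  x - y = x + - y

  -- The list [c₀, …, c_{d-1}] stands for the monic polynomial c₀ + c₁ x + ⋯ + c_{d-1} x^{d-1} + x^d.
  evalMonic : List Carrier → Carrier → Carrier
  evalMonic cs x = foldr (λ c acc → c + x * acc) 1# cs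

  divMonic : Carrier → List Carrier → List Carrier
  divMonic r []            = []
  divMonic r (c ∷ [])      = []
  divMonic r (c ∷ c′ ∷ cs) = evalMonic (c′ ∷ cs) r ∷ divMonic r (c′ ∷ cs)

  length-divMonic : ∀ r c cs → length (divMonic r (c ∷ cs)) ≡ length cs
  length-divMonic r c []        = refl
  length-divMonic r c (c′ ∷ cs) = cong suc (length-divMonic r c′ cs)

  -- Stated with u = x - r, so that the solver never has to cancel r against - r
  -- (it cannot recognise a zero coefficient of F).
  private
    R : AlmostCommutativeRing 0ℓ 0ℓ
    R = fromCommutativeRing commutativeRing (λ _ → nothing)
    module R = AlmostCommutativeRing R

    divMonic-base : ∀ c u r w → c R.+ (u R.+ r) R.* w ≡ u R.* w R.+ (c R.+ r R.* w)
    divMonic-base = solve-∀ R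

    divMonic-step : ∀ c u r q e →
      c R.+ (u R.+ r) R.* (u R.* q R.+ e) ≡ u R.* (e R.+ (u R.+ r) R.* q) R.+ (c R.+ r R.* e)
    divMonic-step = solve-∀ R

  x≡x-y+y : ∀ x y → x ≡ (x - y) + y
  x≡x-y+y x y = sym (trans (+-assoc x (- y) y) (trans (cong (x +_) (-‿inverseˡ y)) (+-identityʳ x)))

  evalMonic-divMonic : ∀ r c cs x →
    evalMonic (c ∷ cs) x ≡ (x - r) * evalMonic (divMonic r (c ∷ cs)) x + evalMonic (c ∷ cs) r
  evalMonic-divMonic r c []        x = begin
    c + x * 1#                                   ≡⟨ cong (λ v → c + v * 1#) (x≡x-y+y x r) ⟩
    c + ((x - r) + r) * 1#                       ≡⟨ divMonic-base c (x - r) r 1# ⟩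
    (x - r) * 1# + (c + r * 1#)                  ∎
  evalMonic-divMonic r c (c′ ∷ cs) x = begin
    c + x * evalMonic (c′ ∷ cs) x                ≡⟨ cong (λ v → c + v * evalMonic (c′ ∷ cs) x) (x≡x-y+y x r) ⟩
    c + ((x - r) + r) * evalMonic (c′ ∷ cs) x    ≡⟨ cong (λ v → c + ((x - r) + r) * v) (evalMonic-divMonic r c′ cs x) ⟩
    c + ((x - r) + r) * ((x - r) * q + e)        ≡⟨ divMonic-step c (x - r) r q e ⟩
    (x - r) * (e + ((x - r) + r) * q) + (c + r * e)
                                                 ≡⟨ cong (λ v → (x - r) * (e + v * q) + (c + r * e)) (sym (x≡x-y+y x r)) ⟩
    (x - r) * (e + x * q) + (c + r * e)          ∎
    where
    q = evalMonic (divMonic r (c′ ∷ cs)) x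
    e = evalMonic (c′ ∷ cs) r

  x-y≡0⇒x≡y : ∀ {x y} → x - y ≡ 0# → x ≡ y
  x-y≡0⇒x≡y {x} {y} x-y≡0 = trans (x≡x-y+y x y) (trans (cong (_+ y) x-y≡0) (+-identityˡ y))

  rootBound : ∀ cs L → Unique L → All (λ x → evalMonic cs x ≡ 0#) L → length L ℕ.≤ length cs
  rootBound cs       []      _                 _               = ℕ.z≤n
  rootBound []       (r ∷ L) _                 (1≡0 ∷ _)       = ⊥-elim (0≢1 (sym 1≡0))
  rootBound (c ∷ cs) (r ∷ L) (r∉L ∷ L-unique) (r-root ∷ roots) =
    ℕ.s≤s (subst (length L ℕ.≤_) (length-divMonic r c cs)
      (rootBound (divMonic r (c ∷ cs)) L L-unique (All.zipWith quotient-root (r∉L , roots))))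
    where
    quotient-root : ∀ {x} → r ≢ x × evalMonic (c ∷ cs) x ≡ 0# → evalMonic (divMonic r (c ∷ cs)) x ≡ 0#
    quotient-root {x} (r≢x , x-root) with xy≈0⇒x≈0∨y≈0 _≟_ (begin
      (x - r) * q                         ≡⟨ sym (+-identityʳ _) ⟩
      (x - r) * q + 0#                    ≡⟨ cong ((x - r) * q +_) (sym r-root) ⟩
      (x - r) * q + evalMonic (c ∷ cs) r  ≡⟨ sym (evalMonic-divMonic r c cs x) ⟩
      evalMonic (c ∷ cs) x                ≡⟨ x-root ⟩
      0#                                  ∎)
      where q = evalMonic (divMonic r (c ∷ cs)) x
    ... | inj₁ x-r≡0 = ⊥-elim (r≢x (sym (x-y≡0⇒x≡y x-r≡0)))
    ... | inj₂ q≡0   = q≡0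

  evalMonic-replicate-0# : ∀ k x → evalMonic (List.replicate k 0#) x ≡ x ^ k
  evalMonic-replicate-0# zero    x = refl
  evalMonic-replicate-0# (suc k) x = trans (+-identityˡ _) (cong (x *_) (evalMonic-replicate-0# k x))

  x^[k+2]≡x⇒order≤k+2 : ∀ k → (∀ x → x ^ suc (suc k) ≡ x) → order ℕ.≤ suc (suc k)
  x^[k+2]≡x⇒order≤k+2 k x^[k+2]≡x = subst₂ ℕ._≤_ length-elems (cong (2 ℕ.+_) (length-replicate k {0#}))
    (rootBound (0# ∷ - 1# ∷ List.replicate k 0#) (elems F) elems-unique (All.tabulate (λ {x} _ → root x)))
    where
    root : ∀ x → 0# + x * (- 1# + x * evalMonic (List.replicate k 0#) x) ≡ 0#
    root x = begin
      0# + x * (- 1# + x * evalMonic (List.replicate k 0#) x)  ≡⟨ +-identityˡ _ ⟩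
      x * (- 1# + x * evalMonic (List.replicate k 0#) x)       ≡⟨ cong (λ v → x * (- 1# + x * v)) (evalMonic-replicate-0# k x) ⟩
      x * (- 1# + x ^ suc k)                                  ≡⟨ distribˡ x (- 1#) _ ⟩
      x * - 1# + x ^ suc (suc k)                              ≡⟨ cong₂ _+_ (sym (-‿distribʳ-* x 1#)) (x^[k+2]≡x x) ⟩
      - (x * 1#) + x                                          ≡⟨ cong (λ v → - v + x) (*-identityʳ x) ⟩
      - x + x                                                 ≡⟨ -‿inverseˡ x ⟩
      0#                                                      ∎

  units-exponent : ∀ {e} → (∀ a → a ≢ 0# → a ^ e ≡ 1#) → order ∸ 1 ∣ e
  units-exponent {e} a^e≡1 with e % (order ∸ 1) in e%Q≡1+g
  ... | zero  = m%n≡0⇒n∣m e (order ∸ 1) e%Q≡1+g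
  ... | suc g = ⊥-elim (ℕₚ.<-irrefl refl (ℕₚ.≤-<-trans (x^[k+2]≡x⇒order≤k+2 g x^[g+2]≡x) g+2<order))
    where
    Q = order ∸ 1
    a^[g+1]≡1 : ∀ a → a ≢ 0# → a ^ suc g ≡ 1#
    a^[g+1]≡1 a a≢0 = begin
      a ^ suc g                               ≡⟨ sym (*-identityʳ _) ⟩
      a ^ suc g * 1#                          ≡⟨ cong (a ^ suc g *_) (sym (1#^≡1# (e / Q))) ⟩
      a ^ suc g * 1# ^ (e / Q)                ≡⟨ cong (λ v → a ^ suc g * v ^ (e / Q)) (sym (fermat a≢0)) ⟩
      a ^ suc g * (a ^ Q) ^ (e / Q)           ≡⟨ cong (a ^ suc g *_) (^-assocʳ a Q (e / Q)) ⟩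
      a ^ suc g * a ^ (Q ℕ.* (e / Q))         ≡⟨ sym (^-homo-* a (suc g) _) ⟩
      a ^ (suc g ℕ.+ Q ℕ.* (e / Q))           ≡⟨ cong (a ^_) (sym e≡g+Q[e/Q]) ⟩
      a ^ e                                   ≡⟨ a^e≡1 a a≢0 ⟩
      1#                                      ∎
      where
      e≡g+Q[e/Q] : e ≡ suc g ℕ.+ Q ℕ.* (e / Q)
      e≡g+Q[e/Q] = trans (m≡m%n+[m/n]*n e Q) (cong₂ ℕ._+_ e%Q≡1+g (ℕₚ.*-comm (e / Q) Q))
    x^[g+2]≡x : ∀ x → x ^ suc (suc g) ≡ x
    x^[g+2]≡x x with x ≟ 0#
    ... | yes x≡0 = trans (cong (_^ suc (suc g)) x≡0) (trans (zeroˡ _) (sym x≡0))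
    ... | no  x≢0 = trans (cong (x *_) (a^[g+1]≡1 x x≢0)) (*-identityʳ x)
    g+2<order : suc (suc g) ℕ.< order
    g+2<order = subst (suc (suc g) ℕ.<_) (sym order≡suc[order∸1]) (ℕ.s≤s (subst (ℕ._< Q) e%Q≡1+g (m%n<n e Q)))

  powerSum : ℕ → Carrier
  powerSum e = ∑ (elems F) (_^ e)

  powerSum-*-invariant : ∀ {a} → a ≢ 0# → ∀ e → a ^ e * powerSum e ≡ powerSum e
  powerSum-*-invariant {a} a≢0 e = begin
    a ^ e * powerSum e                  ≡⟨ sym (∑-*ˡ (elems F) (a ^ e) (_^ e)) ⟩
    ∑ (elems F) (λ x → a ^ e * x ^ e)   ≡⟨ ∑M.fold-cong (elems F) (λ x → sym (^-distrib-* a x e)) ⟩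
    ∑ (elems F) ((_^ e) ∘ (a *_))       ≡⟨ ∑-*-invariant a≢0 (_^ e) ⟩
    powerSum e                          ∎

  powerSum-0 : powerSum 0 ≡ 0#
  powerSum-0 = trans (∑-1# (elems F)) (trans (cong (_· 1#) length-elems) order·1≡0)

  powerSum-vanishes-unless : ∀ e → powerSum e ≡ 0# ⊎ (0 ℕ.< e × order ∸ 1 ∣ e)
  powerSum-vanishes-unless zero = inj₁ powerSum-0
  powerSum-vanishes-unless e@(suc _) with powerSum e ≟ 0#
  ... | yes S≡0 = inj₁ S≡0
  ... | no  S≢0 = inj₂ (ℕ.s≤s ℕ.z≤n , units-exponent (λ a a≢0 → a^e≡1 a≢0))
    where
    a^e≡1 : ∀ {a} → a ≢ 0# → a ^ e ≡ 1#
    a^e≡1 {a} a≢0 = *-almostCancelʳ _ _ _ S≢0 (trans (powerSum-*-invariant a≢0 e) (sym (*-identityˡ _)))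

  indicator : Bool → Carrier
  indicator true  = 1#
  indicator false = 0#

  length-filterᵇ : {X : Set} (b : X → Bool) (L : List X) → length (filterᵇ b L) · 1# ≡ ∑ L (indicator ∘ b)
  length-filterᵇ b []      = refl
  length-filterᵇ b (x ∷ L) with b x
  ... | true  = cong (1# +_) (length-filterᵇ b L)
  ... | false = trans (length-filterᵇ b L) (sym (+-identityˡ _))

  indicator-all : {X : Set} (b : X → Bool) (L : List X) → indicator (foldr _∧_ true (map b L)) ≡ ∏ L (indicator ∘ b)
  indicator-all b []      = refl
  indicator-all b (x ∷ L) with b x
  ... | true  = trans (indicator-all b L) (sym (*-identityˡ _))
  ... | false = sym (zeroˡ _)

  -- Polynomials in n variables

  1ₚ : ∀ {n} → Poly F n
  1ₚ {n} = (1# , Vec.replicate n 0) ∷ []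

  _*ₜ_ : ∀ {n} → Term F n → Term F n → Term F n
  (a , e) *ₜ (b , e′) = a * b , Vec.zipWith ℕ._+_ e e′

  _*ₚ_ : ∀ {n} → Poly F n → Poly F n → Poly F n
  A *ₚ B = concatMap (λ t → map (t *ₜ_) B) A

  -ₚ_ : ∀ {n} → Poly F n → Poly F n
  -ₚ_ = map (map₁ (λ a → - a))

  _^ₚ_ : ∀ {n} → Poly F n → ℕ → Poly F n
  A ^ₚ zero  = 1ₚ
  A ^ₚ suc k = A *ₚ (A ^ₚ k)

  ∏ₚ : ∀ {n} {X : Set} → List X → (X → Poly F n) → Poly F n
  ∏ₚ L f = foldr (λ x acc → f x *ₚ acc) 1ₚ L

  -- eval F A y unfolds to ∑ A (evalTerm y).
  evalTerm : ∀ {n} → Vec Carrier n → Term F n → Carrier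
  evalTerm y (a , e) = a * monoEval F y e

  monoEval-replicate-0 : ∀ {n} (y : Vec Carrier n) → monoEval F y (Vec.replicate n 0) ≡ 1#
  monoEval-replicate-0 []      = refl
  monoEval-replicate-0 (x ∷ y) = trans (*-identityˡ _) (monoEval-replicate-0 y)

  monoEval-+ : ∀ {n} (y : Vec Carrier n) e e′ → monoEval F y (Vec.zipWith ℕ._+_ e e′) ≡ monoEval F y e * monoEval F y e′
  monoEval-+ []      []      []        = sym (*-identityˡ 1#)
  monoEval-+ (x ∷ y) (a ∷ e) (b ∷ e′) = begin
    pow F x (a ℕ.+ b) * monoEval F y (Vec.zipWith ℕ._+_ e e′)          ≡⟨ cong₂ _*_ (pow-homo-+ x a b) (monoEval-+ y e e′) ⟩
    (pow F x a * pow F x b) * (monoEval F y e * monoEval F y e′)       ≡⟨ *-interchange _ _ _ _ ⟩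
    (pow F x a * monoEval F y e) * (pow F x b * monoEval F y e′)       ∎
    where
    pow-homo-+ : ∀ x a b → pow F x (a ℕ.+ b) ≡ pow F x a * pow F x b
    pow-homo-+ x a b = trans (pow≗^ x (a ℕ.+ b)) (trans (^-homo-* x a b) (sym (cong₂ _*_ (pow≗^ x a) (pow≗^ x b))))

  evalTerm-*ₜ : ∀ {n} (y : Vec Carrier n) s t → evalTerm y (s *ₜ t) ≡ evalTerm y s * evalTerm y t
  evalTerm-*ₜ y (a , e) (b , e′) = trans (cong (a * b *_) (monoEval-+ y e e′)) (*-interchange a b _ _)

  eval-++ : ∀ {n} (A B : Poly F n) y → eval F (A ++ B) y ≡ eval F A y + eval F B y
  eval-++ A B y = ∑M.fold-++ A B (evalTerm y)

  eval-*ₚ : ∀ {n} (A B : Poly F n) y → eval F (A *ₚ B) y ≡ eval F A y * eval F B y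
  eval-*ₚ A B y = begin
    ∑ (concatMap (λ t → map (t *ₜ_) B) A) (evalTerm y)  ≡⟨ ∑M.fold-concatMap A _ (evalTerm y) ⟩
    ∑ A (λ s → ∑ (map (s *ₜ_) B) (evalTerm y))          ≡⟨ ∑M.fold-cong A (λ s → ∑M.fold-map B (s *ₜ_) (evalTerm y)) ⟩
    ∑ A (λ s → ∑ B (λ t → evalTerm y (s *ₜ t)))         ≡⟨ ∑M.fold-cong A (λ s → ∑M.fold-cong B (evalTerm-*ₜ y s)) ⟩
    ∑ A (λ s → ∑ B (λ t → evalTerm y s * evalTerm y t)) ≡⟨ ∑M.fold-cong A (λ s → ∑-*ˡ B (evalTerm y s) (evalTerm y)) ⟩
    ∑ A (λ s → evalTerm y s * eval F B y)               ≡⟨ ∑-*ʳ A (eval F B y) (evalTerm y) ⟩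
    eval F A y * eval F B y                             ∎

  eval--ₚ : ∀ {n} (A : Poly F n) y → eval F (-ₚ A) y ≡ - eval F A y
  eval--ₚ []            y = sym -0#≈0#
  eval--ₚ ((a , e) ∷ A) y = begin
    - a * monoEval F y e + eval F (-ₚ A) y      ≡⟨ cong₂ _+_ (sym (-‿distribˡ-* a _)) (eval--ₚ A y) ⟩
    - (a * monoEval F y e) + - eval F A y      ≡⟨ -‿+-comm _ _ ⟩
    - (a * monoEval F y e + eval F A y)        ∎

  eval-1ₚ : ∀ {n} (y : Vec Carrier n) → eval F 1ₚ y ≡ 1#
  eval-1ₚ y = trans (+-identityʳ _) (trans (cong (1# *_) (monoEval-replicate-0 y)) (*-identityˡ 1#))

  eval-^ₚ : ∀ {n} (A : Poly F n) k y → eval F (A ^ₚ k) y ≡ eval F A y ^ k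
  eval-^ₚ A zero    y = eval-1ₚ y
  eval-^ₚ A (suc k) y = trans (eval-*ₚ A (A ^ₚ k) y) (cong (eval F A y *_) (eval-^ₚ A k y))

  eval-∏ₚ : ∀ {n} {X : Set} (L : List X) (f : X → Poly F n) y → eval F (∏ₚ L f) y ≡ ∏ L (λ x → eval F (f x) y)
  eval-∏ₚ []      f y = eval-1ₚ y
  eval-∏ₚ (x ∷ L) f y = trans (eval-*ₚ (f x) (∏ₚ L f) y) (cong (eval F (f x) y *_) (eval-∏ₚ L f y))

  module _ {n : ℕ} (I : Subset n) where
    1ₚ-degree : DegreeI≤ I 0 (1ₚ {n})
    1ₚ-degree = ℕₚ.≤-reflexive (monoDegI-replicate-0 I) ∷ []

    -ₚ-degree : ∀ {D} (A : Poly F n) → DegreeI≤ I D A → DegreeI≤ I D (-ₚ A)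
    -ₚ-degree A = Allₚ.map⁺ ∘ All.map id

    *ₚ-degree : ∀ {D D′} (A B : Poly F n) → DegreeI≤ I D A → DegreeI≤ I D′ B → DegreeI≤ I (D ℕ.+ D′) (A *ₚ B)
    *ₚ-degree []      B []          _  = []
    *ₚ-degree (s ∷ A) B (s≤D ∷ A≤D) B≤D′ = Allₚ.++⁺ (Allₚ.map⁺ (All.map (λ {t} t≤D′ →
        subst (ℕ._≤ _) (sym (monoDegI-+ I (proj₂ s) (proj₂ t))) (ℕₚ.+-mono-≤ s≤D t≤D′)) B≤D′))
      (*ₚ-degree A B A≤D B≤D′)

    ^ₚ-degree : ∀ {D} (A : Poly F n) k → DegreeI≤ I D A → DegreeI≤ I (k ℕ.* D) (A ^ₚ k)
    ^ₚ-degree A zero    _   = 1ₚ-degree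
    ^ₚ-degree A (suc k) A≤D = *ₚ-degree A (A ^ₚ k) A≤D (^ₚ-degree A k A≤D)

    ∏ₚ-degree : {X : Set} (L : List X) (f : X → Poly F n) (d : X → ℕ) → (∀ x → DegreeI≤ I (d x) (f x)) →
                DegreeI≤ I (foldr ℕ._+_ 0 (map d L)) (∏ₚ L f)
    ∏ₚ-degree []      f d _   = 1ₚ-degree
    ∏ₚ-degree (x ∷ L) f d f≤d = *ₚ-degree (f x) (∏ₚ L f) (f≤d x) (∏ₚ-degree L f d f≤d)

  0#^ : ∀ k .{{_ : ℕ.NonZero k}} → 0# ^ k ≡ 0#
  0#^ (suc k) = zeroˡ _

  zeroIndicatorₚ : ∀ {n} → Poly F n → Poly F n
  zeroIndicatorₚ A = 1ₚ ++ -ₚ (A ^ₚ (order ∸ 1))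

  eval-zeroIndicatorₚ : ∀ {n} (A : Poly F n) y → eval F (zeroIndicatorₚ A) y ≡ indicator ⌊ eval F A y ≟ 0# ⌋
  eval-zeroIndicatorₚ A y = begin
    eval F (1ₚ ++ -ₚ (A ^ₚ (order ∸ 1))) y               ≡⟨ eval-++ 1ₚ (-ₚ (A ^ₚ (order ∸ 1))) y ⟩
    eval F 1ₚ y + eval F (-ₚ (A ^ₚ (order ∸ 1))) y       ≡⟨ cong₂ _+_ (eval-1ₚ y) (eval--ₚ (A ^ₚ (order ∸ 1)) y) ⟩
    1# + - eval F (A ^ₚ (order ∸ 1)) y                   ≡⟨ cong (λ v → 1# + - v) (eval-^ₚ A (order ∸ 1) y) ⟩
    1# + - (eval F A y ^ (order ∸ 1))                    ≡⟨ 1-a^[q-1] (eval F A y) ⟩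
    indicator ⌊ eval F A y ≟ 0# ⌋                        ∎
    where
    1-a^[q-1] : ∀ a → 1# + - (a ^ (order ∸ 1)) ≡ indicator ⌊ a ≟ 0# ⌋
    1-a^[q-1] a with a ≟ 0#
    ... | yes refl = trans (cong (λ v → 1# + - v) (0#^ (order ∸ 1))) (trans (cong (1# +_) -0#≈0#) (+-identityʳ 1#))
    ... | no  a≢0  = trans (cong (λ v → 1# + - v) (fermat a≢0)) (-‿inverseʳ 1#)

  zeroIndicatorₚ-degree : ∀ {n} (I : Subset n) {D} (A : Poly F n) → DegreeI≤ I D A →
                          DegreeI≤ I ((order ∸ 1) ℕ.* D) (zeroIndicatorₚ A)
  zeroIndicatorₚ-degree I A A≤D = Allₚ.++⁺ (DegreeI≤-weaken {I = I} ℕ.z≤n (1ₚ-degree I))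
    (-ₚ-degree I (A ^ₚ (order ∸ 1)) (^ₚ-degree I A (order ∸ 1) A≤D))

  -- Sums over Fⁿ

  evalEach : ∀ {n} → (Fin n → UPoly F) → Vec Carrier n → Vec Carrier n
  evalEach f x = Vec.tabulate (λ i → evalU F (f i) (Vec.lookup x i))

  zeroCount·1≡∑ : ∀ n r (f : Fin n → UPoly F) (P : Fin r → Poly F n) →
    zeroCount F n r f P · 1# ≡ ∑ (allVecs F n) (λ x → eval F (∏ₚ (allFin r) (zeroIndicatorₚ ∘ P)) (evalEach f x))
  zeroCount·1≡∑ n r f P = trans (length-filterᵇ _ (allVecs F n)) (∑M.fold-cong (allVecs F n) (λ x → begin
    indicator (foldr _∧_ true (map (λ j → ⌊ eval F (P j) (evalEach f x) ≟ 0# ⌋) (allFin r)))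
      ≡⟨ indicator-all _ (allFin r) ⟩
    ∏ (allFin r) (λ j → indicator ⌊ eval F (P j) (evalEach f x) ≟ 0# ⌋)
      ≡⟨ ∏M.fold-cong (allFin r) (λ j → sym (eval-zeroIndicatorₚ (P j) (evalEach f x))) ⟩
    ∏ (allFin r) (λ j → eval F (zeroIndicatorₚ (P j)) (evalEach f x))
      ≡⟨ sym (eval-∏ₚ (allFin r) (zeroIndicatorₚ ∘ P) (evalEach f x)) ⟩
    eval F (∏ₚ (allFin r) (zeroIndicatorₚ ∘ P)) (evalEach f x) ∎))

  ∑-eval-vanishes : ∀ {n} {X : Set} (L : List X) (y : X → Vec Carrier n) (A : Poly F n) →
    All (λ t → ∑ L (λ x → monoEval F (y x) (proj₂ t)) ≡ 0#) A → ∑ L (λ x → eval F A (y x)) ≡ 0#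
  ∑-eval-vanishes L y []            []                  = ∑M.fold-ε L
  ∑-eval-vanishes L y ((a , e) ∷ A) (∑monoEval≡0 ∷ A≡0) = begin
    ∑ L (λ x → a * monoEval F (y x) e + eval F A (y x))       ≡⟨ ∑M.fold-∙ L _ _ ⟩
    ∑ L (λ x → a * monoEval F (y x) e) + ∑ L (λ x → eval F A (y x))
      ≡⟨ cong₂ _+_ (trans (∑-*ˡ L a _) (trans (cong (a *_) ∑monoEval≡0) (zeroʳ a))) (∑-eval-vanishes L y A A≡0) ⟩
    0# + 0#                                                   ≡⟨ +-identityʳ 0# ⟩
    0#                                                        ∎

  monoEval-tabulate : ∀ {n} (h : Fin n → Carrier) (k : Vec ℕ n) →
                      monoEval F (Vec.tabulate h) k ≡ ∏ (allFin n) (λ i → h i ^ Vec.lookup k i)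
  monoEval-tabulate h []      = refl
  monoEval-tabulate h (a ∷ k) = trans (cong₂ _*_ (pow≗^ (h zero) a) (monoEval-tabulate (h ∘ suc) k))
                                      (sym (∏M.fold-allFin-suc (λ i → h i ^ Vec.lookup (a ∷ k) i)))

  ∑-allVecs-∏ : ∀ n (h : Fin n → Carrier → Carrier) →
    ∑ (allVecs F n) (λ x → ∏ (allFin n) (λ i → h i (Vec.lookup x i))) ≡ ∏ (allFin n) (λ i → ∑ (elems F) (h i))
  ∑-allVecs-∏ zero    h = +-identityʳ 1#
  ∑-allVecs-∏ (suc n) h = begin
    ∑ (concatMap (λ z → map (z ∷_) (allVecs F n)) (elems F)) G
      ≡⟨ ∑M.fold-concatMap (elems F) _ G ⟩
    ∑ (elems F) (λ z → ∑ (map (z ∷_) (allVecs F n)) G)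
      ≡⟨ ∑M.fold-cong (elems F) (λ z → ∑M.fold-map (allVecs F n) (z ∷_) G) ⟩
    ∑ (elems F) (λ z → ∑ (allVecs F n) (G ∘ (z ∷_)))
      ≡⟨ ∑M.fold-cong (elems F) (λ z → ∑M.fold-cong (allVecs F n) (λ x →
           ∏M.fold-allFin-suc (λ i → h i (Vec.lookup (z ∷ x) i)))) ⟩
    ∑ (elems F) (λ z → ∑ (allVecs F n) (λ x → h zero z * ∏ (allFin n) (λ i → h (suc i) (Vec.lookup x i))))
      ≡⟨ ∑M.fold-cong (elems F) (λ z →
           trans (∑-*ˡ (allVecs F n) (h zero z) _) (cong (h zero z *_) (∑-allVecs-∏ n (h ∘ suc)))) ⟩
    ∑ (elems F) (λ z → h zero z * ∏ (allFin n) (λ i → ∑ (elems F) (h (suc i))))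
      ≡⟨ ∑-*ʳ (elems F) _ (h zero) ⟩
    ∑ (elems F) (h zero) * ∏ (allFin n) (λ i → ∑ (elems F) (h (suc i)))
      ≡⟨ sym (∏M.fold-allFin-suc (λ i → ∑ (elems F) (h i))) ⟩
    ∏ (allFin (suc n)) (λ i → ∑ (elems F) (h i)) ∎
    where
    G : Vec Carrier (suc n) → Carrier
    G x = ∏ (allFin (suc n)) (λ i → h i (Vec.lookup x i))

  ∏-vanishes-unless : {X : Set} {P : X → Set} (L : List X) (g : X → Carrier) →
                      (∀ x → g x ≡ 0# ⊎ P x) → ∏ L g ≡ 0# ⊎ All P L
  ∏-vanishes-unless []      g g≡0⊎P = inj₂ []
  ∏-vanishes-unless (x ∷ L) g g≡0⊎P with g≡0⊎P x | ∏-vanishes-unless L g g≡0⊎P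
  ... | inj₁ gx≡0 | _          = inj₁ (trans (cong (_* ∏ L g) gx≡0) (zeroˡ _))
  ... | inj₂ _    | inj₁ ∏≡0   = inj₁ (trans (cong (g x *_) ∏≡0) (zeroʳ _))
  ... | inj₂ Px   | inj₂ All-P = inj₂ (Px ∷ All-P)

  evalU-tPow : ∀ m z → evalU F (tPow F m) z ≡ z ^ m
  evalU-tPow zero    z = trans (cong (1# +_) (zeroʳ z)) (+-identityʳ 1#)
  evalU-tPow (suc m) z = trans (+-identityˡ _) (cong (z *_) (evalU-tPow m z))

  tPowSum-vanishes-unless : ∀ m k →
    ∑ (elems F) (λ z → evalU F (tPow F m) z ^ k) ≡ 0# ⊎ (0 ℕ.< m ℕ.* k × order ∸ 1 ∣ m ℕ.* k)
  tPowSum-vanishes-unless m k = Sum.map₁ (trans (∑M.fold-cong (elems F) (λ z → begin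
    evalU F (tPow F m) z ^ k    ≡⟨ cong (_^ k) (evalU-tPow m z) ⟩
    (z ^ m) ^ k                 ≡⟨ ^-assocʳ z m k ⟩
    z ^ (m ℕ.* k)               ∎))) (powerSum-vanishes-unless (m ℕ.* k))

  monomialSum-vanishes-unless : ∀ {n} (f : Fin n → UPoly F) (m : Fin n → ℕ) (I : Subset n) →
    (∀ i → i ∈ I → f i ≡ tPow F (m i)) → (k : Vec ℕ n) →
    ∑ (allVecs F n) (λ x → monoEval F (evalEach f x) k) ≡ 0#
      ⊎ (∀ i → i ∈ I → 0 ℕ.< m i ℕ.* Vec.lookup k i × order ∸ 1 ∣ m i ℕ.* Vec.lookup k i)
  monomialSum-vanishes-unless {n} f m I f≡tPow k =
    Sum.map (trans ∑≡∏) Allₚ.tabulate⁻ (∏-vanishes-unless (allFin n) (λ i → ∑ (elems F) (h i)) coordinate-vanishes-unless)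
    where
    h : Fin n → Carrier → Carrier
    h i z = evalU F (f i) z ^ Vec.lookup k i
    ∑≡∏ : ∑ (allVecs F n) (λ x → monoEval F (evalEach f x) k) ≡ ∏ (allFin n) (λ i → ∑ (elems F) (h i))
    ∑≡∏ = trans (∑M.fold-cong (allVecs F n) (λ x → monoEval-tabulate _ k)) (∑-allVecs-∏ n h)
    coordinate-vanishes-unless : ∀ i → ∑ (elems F) (h i) ≡ 0#
      ⊎ (i ∈ I → 0 ℕ.< m i ℕ.* Vec.lookup k i × order ∸ 1 ∣ m i ℕ.* Vec.lookup k i)
    coordinate-vanishes-unless i with i ∈? I
    ... | no  i∉I = inj₂ (λ i∈I → ⊥-elim (i∉I i∈I))
    ... | yes i∈I rewrite f≡tPow i i∈I = Sum.map₂ (λ good _ → good) (tPowSum-vanishes-unless (m i) (Vec.lookup k i))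

-- The degree inequality

Q≤gcd[m,Q]*k : ∀ {Q} m k → 0 ℕ.< m ℕ.* k → Q ∣ m ℕ.* k → Q ℕ.≤ gcd m Q ℕ.* k
Q≤gcd[m,Q]*k {Q} m k 0<mk Q∣mk = ∣⇒≤ {{gcd*k-nonZero}} (subst (Q ∣_) k*gcd≡gcd*k
  (gcd-greatest (subst (Q ∣_) (ℕₚ.*-comm m k) Q∣mk) (n∣m*n k)))
  where
  instance
    mk-nonZero : ℕ.NonZero (m ℕ.* k)
    mk-nonZero = ℕ.>-nonZero 0<mk
  gcd*k-nonZero : ℕ.NonZero (gcd m Q ℕ.* k)
  gcd*k-nonZero = ℕₚ.m*n≢0 _ k {{ℕ.≢-nonZero (gcd[m,n]≢0 m Q (inj₁ (ℕ.≢-nonZero⁻¹ m {{ℕₚ.m*n≢0⇒m≢0 m}})))}}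
                              {{ℕₚ.m*n≢0⇒n≢0 m}}
  k*gcd≡gcd*k : gcd (k ℕ.* m) (k ℕ.* Q) ≡ gcd m Q ℕ.* k
  k*gcd≡gcd*k = trans (sym (c*gcd[m,n]≡gcd[cm,cn] k m Q)) (ℕₚ.*-comm k _)

open import Data.Integer as ℤ using (+_)
import Data.Integer.Properties as ℤₚ
open import Data.Nat using (_^_; _<_)

-- toℚ a is (+ a) ℚ./ 1 already in normal form, so that ℚ._+_ and ℚ._*_ on it unfold to integer arithmetic.
toℚ : ℕ → ℚ
toℚ a = mkℚ (+ a) 0 (Coprimality.sym (1-coprimeTo a))

+a/1≡toℚ : ∀ a → (+ a) ℚ./ 1 ≡ toℚ a
+a/1≡toℚ a = ℚₚ.normalize-coprime _

toℚ-+ : ∀ a b → toℚ (a ℕ.+ b) ≡ toℚ a ℚ.+ toℚ b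
toℚ-+ a b = trans (sym (+a/1≡toℚ (a ℕ.+ b)))
  (ℚₚ./-cong (trans (ℤₚ.pos-+ a b) (sym (cong₂ ℤ._+_ (ℤₚ.*-identityʳ (+ a)) (ℤₚ.*-identityʳ (+ b))))) refl)

toℚ-* : ∀ a b → toℚ (a ℕ.* b) ≡ toℚ a ℚ.* toℚ b
toℚ-* a b = trans (sym (+a/1≡toℚ (a ℕ.* b))) (ℚₚ./-cong (ℤₚ.pos-* a b) refl)

toℚ-mono-≤ : ∀ {a b} → a ℕ.≤ b → toℚ a ℚ.≤ toℚ b
toℚ-mono-≤ {a} {b} a≤b =
  ℚ.*≤* (subst₂ ℤ._≤_ (sym (ℤₚ.*-identityʳ (+ a))) (sym (ℤₚ.*-identityʳ (+ b))) (ℤ.+≤+ a≤b))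

toℚ*invℕ≡1 : ∀ d → toℚ (suc d) ℚ.* invℕ (suc d) ≡ 1ℚ
toℚ*invℕ≡1 d =
  trans (cong (toℚ (suc d) ℚ.*_) (ℚₚ.normalize-coprime (1-coprimeTo (suc d)))) (ℚₚ.*-inverseʳ (toℚ (suc d)))

-- For d = 0 this holds because invℕ 0 = 0ℚ.
toℚ*invℕ≤ : ∀ {Q d k} → Q ℕ.≤ d ℕ.* k → toℚ Q ℚ.* invℕ d ℚ.≤ toℚ k
toℚ*invℕ≤ {Q} {zero}  {k} _       = subst (ℚ._≤ toℚ k) (sym (ℚₚ.*-zeroʳ (toℚ Q))) (toℚ-mono-≤ ℕ.z≤n)
toℚ*invℕ≤ {Q} {suc d} {k} Q≤d*k = begin
  toℚ Q ℚ.* invℕ (suc d)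
    ≤⟨ ℚₚ.*-monoʳ-≤-nonNeg (invℕ (suc d)) {{invℕ-nonNeg}} (toℚ-mono-≤ Q≤d*k) ⟩
  toℚ (suc d ℕ.* k) ℚ.* invℕ (suc d)
    ≡⟨ cong (ℚ._* invℕ (suc d)) (trans (toℚ-* (suc d) k) (ℚₚ.*-comm (toℚ (suc d)) (toℚ k))) ⟩
  toℚ k ℚ.* toℚ (suc d) ℚ.* invℕ (suc d)          ≡⟨ ℚₚ.*-assoc (toℚ k) (toℚ (suc d)) (invℕ (suc d)) ⟩
  toℚ k ℚ.* (toℚ (suc d) ℚ.* invℕ (suc d))        ≡⟨ cong (toℚ k ℚ.*_) (toℚ*invℕ≡1 d) ⟩
  toℚ k ℚ.* 1ℚ                                    ≡⟨ ℚₚ.*-identityʳ (toℚ k) ⟩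
  toℚ k                                           ∎
  where
  open ℚₚ.≤-Reasoning
  invℕ-nonNeg : ℚ.NonNegative (invℕ (suc d))
  invℕ-nonNeg = ℚₚ.normalize-nonNeg 1 (suc d)

sumOver-∷ : ∀ {n} b (I : Subset n) (g : Fin (suc n) → ℚ) →
            sumOver (b ∷ I) g ≡ (if b then g zero else 0ℚ) ℚ.+ sumOver I (g ∘ suc)
sumOver-∷ {n} b I g = cong (λ gs → h zero ℚ.+ foldr ℚ._+_ 0ℚ gs)
  (trans (map-tabulate suc h) (sym (map-tabulate id (h ∘ suc))))
  where
  h : Fin (suc n) → ℚ
  h i = if Vec.lookup (b ∷ I) i then g i else 0ℚ

toℚ*sumOver-invℕ≤ : ∀ {n} (I : Subset n) Q (d : Fin n → ℕ) (k : Vec ℕ n) →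
  (∀ i → i ∈ I → Q ℕ.≤ d i ℕ.* Vec.lookup k i) → toℚ Q ℚ.* sumOver I (invℕ ∘ d) ℚ.≤ toℚ (monoDegI I k)
toℚ*sumOver-invℕ≤ []      Q d []      _     = ℚₚ.≤-reflexive (ℚₚ.*-zeroʳ (toℚ Q))
toℚ*sumOver-invℕ≤ (b ∷ I) Q d (a ∷ k) Q≤d*k = begin
  toℚ Q ℚ.* sumOver (b ∷ I) (invℕ ∘ d)        ≡⟨ cong (toℚ Q ℚ.*_) (sumOver-∷ b I (invℕ ∘ d)) ⟩
  toℚ Q ℚ.* (inv₀ ℚ.+ S)                      ≡⟨ ℚₚ.*-distribˡ-+ (toℚ Q) inv₀ S ⟩
  toℚ Q ℚ.* inv₀ ℚ.+ toℚ Q ℚ.* S              ≤⟨ ℚₚ.+-mono-≤ (head-bound b Q≤d*k) tail-bound ⟩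
  toℚ (if b then a else 0) ℚ.+ toℚ (monoDegI I k)
                                              ≡⟨ sym (toℚ-+ (if b then a else 0) (monoDegI I k)) ⟩
  toℚ (monoDegI (b ∷ I) (a ∷ k))              ∎
  where
  open ℚₚ.≤-Reasoning
  inv₀ = if b then invℕ (d zero) else 0ℚ
  S = sumOver I (invℕ ∘ d ∘ suc)
  tail-bound : toℚ Q ℚ.* S ℚ.≤ toℚ (monoDegI I k)
  tail-bound = toℚ*sumOver-invℕ≤ I Q (d ∘ suc) k (λ i i∈I → Q≤d*k (suc i) (there i∈I))
  head-bound : ∀ b → (∀ i → i ∈ b ∷ I → Q ℕ.≤ d i ℕ.* Vec.lookup (a ∷ k) i) →
               toℚ Q ℚ.* (if b then invℕ (d zero) else 0ℚ) ℚ.≤ toℚ (if b then a else 0)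
  head-bound true  Q≤d*k = toℚ*invℕ≤ {Q} {d zero} {a} (Q≤d*k zero here)
  head-bound false _     = ℚₚ.≤-reflexive (ℚₚ.*-zeroʳ (toℚ Q))

sumOver-invℕ-gcd≤ : ∀ {n} (I : Subset n) Q .{{_ : ℕ.NonZero Q}} D (m : Fin n → ℕ) (k : Vec ℕ n) →
  (∀ i → i ∈ I → 0 ℕ.< m i ℕ.* Vec.lookup k i × Q ∣ m i ℕ.* Vec.lookup k i) → monoDegI I k ℕ.≤ Q ℕ.* D →
  sumOver I (λ i → invℕ (gcd (m i) Q)) ℚ.≤ (+ D) ℚ./ 1
sumOver-invℕ-gcd≤ I (suc Q) D m k divisible k≤QD = ℚₚ.*-cancelˡ-≤-pos (toℚ (suc Q)) (begin
  toℚ (suc Q) ℚ.* sumOver I (λ i → invℕ (gcd (m i) (suc Q)))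
    ≤⟨ toℚ*sumOver-invℕ≤ I (suc Q) (λ i → gcd (m i) (suc Q)) k
         (λ i i∈I → uncurry (Q≤gcd[m,Q]*k (m i) _) (divisible i i∈I)) ⟩
  toℚ (monoDegI I k)               ≤⟨ toℚ-mono-≤ k≤QD ⟩
  toℚ (suc Q ℕ.* D)                ≡⟨ toℚ-* (suc Q) D ⟩
  toℚ (suc Q) ℚ.* toℚ D            ≡⟨ cong (toℚ (suc Q) ℚ.*_) (sym (+a/1≡toℚ D)) ⟩
  toℚ (suc Q) ℚ.* ((+ D) ℚ./ 1)    ∎)
  where open ℚₚ.≤-Reasoning

corollary1p8 : (F : FiniteField) (p s : ℕ) → Prime p → FiniteField.order F ≡ p ^ s →
    (n r : ℕ) (P : Fin r → Poly F n) →
    (∀ j → IsNormal F (P j)) → (∀ j → ¬ (P j ≡ [])) →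
    (I : Subset n) → Nonempty I →
    (f : Fin n → UPoly F) (m : Fin n → ℕ) →
    (∀ i → i ∈ I → (0 < m i) × (f i ≡ tPow F (m i))) →
    ((+ sumℕ (λ j → degI I (P j))) ℚ./ 1)
      ℚ.< sumOver I (λ i → invℕ (gcd (m i) (FiniteField.order F ∸ 1))) →
    p ∣ zeroCount F n r f P
corollary1p8 F p s p-prime order≡p^s n r P _ _ I _ f m f≡tPow D<∑ =
  prime-∣-char F p-prime (p·1≡0 F {p} {s} order≡p^s)
    (trans (zeroCount·1≡∑ F n r f P) (∑-eval-vanishes F (allVecs F n) (evalEach F f) χ monomials-vanish))
  where
  open FiniteField F using (0#; order)
  D = sumℕ (λ j → degI I (P j))
  χ = ∏ₚ F (allFin r) (zeroIndicatorₚ F ∘ P)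
  χ-degree : DegreeI≤ I ((order ∸ 1) ℕ.* D) χ
  χ-degree = subst (λ D′ → DegreeI≤ I D′ χ) (foldr-+-map-*ˡ (order ∸ 1) (λ j → degI I (P j)) (allFin r))
    (∏ₚ-degree F I (allFin r) (zeroIndicatorₚ F ∘ P) _ (λ j → zeroIndicatorₚ-degree F I (P j) (degI-DegreeI≤ I (P j))))
  monomials-vanish : All (λ t → ∑ F (allVecs F n) (λ x → monoEval F (evalEach F f x) (proj₂ t)) ≡ 0#) χ
  monomials-vanish = All.map (λ {t} t≤QD →
    Sum.[ id , (λ divisible → ⊥-elim (ℚₚ.<-irrefl refl (ℚₚ.<-≤-trans D<∑
                 (sumOver-invℕ-gcd≤ I (order ∸ 1) {{order∸1-nonZero F}} D m (proj₂ t) divisible t≤QD)))) ]′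
      (monomialSum-vanishes-unless F f m I (λ i i∈I → proj₂ (f≡tPow i i∈I)) (proj₂ t))) χ-degree
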